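{- There exists a vector $h=(h_0,h_1,\ldots,h_d)$ of nonnegative integers (for some $d\ge1$) such that: $h$ is unimodal; $\Pi(h,h)$ is not unimodal; and, letting $s$ denote the largest index with $h_s\neq 0$, $h$ satisfies all of the following inequalities: (1) $h_1\ge h_d$; (2) $h_2+h_3+\cdots+h_i\ge h_{d-1}+h_{d-2}+\cdots+h_{d-i+1}$ for every $2\le i\le\lfloor d/2\rfloor$; (3) $h_0+h_1+\cdots+h_i\le h_s+h_{s-1}+\cdots+h_{s-i}$ for every $0\le i\le\lfloor s/2\rfloor$; (4) if $s=d$, then $h_1\le h_i$ for all $1\le i\le d-1$; (5) if $s\le d-1$, then $h_0+h_1\le h_i+h_{i-1}+\cdots+h_{i-(d-s)}$ for all $1\le i\le d-1$.
   Context: A vector $(a_0,\dots,a_D)$ is unimodal if there is an index $i$ with $a_0\le\cdots\le a_i\ge a_{i+1}\ge\cdots\ge a_D$. For a real vector $h=(h_0,\dots,h_d)$ of length $d+1$, let $\mathscr{E}(h)$ be the polynomial $\mathscr{E}(h)(x)=\sum_{i=0}^d h_i\binom{x+d-i}{d}$. For two real vectors $h$ of length $d+1$ and $h'$ of length $d'+1$, let $D=d+d'$ and define $\Pi(h,h')=(g_0,\dots,g_D)$ to be the unique vector of length $D+1$ such that, as formal power series, $\sum_{t\ge0}\mathscr{E}(h)(t)\,\mathscr{E}(h')(t)\,x^t=\frac{\sum_{j=0}^D g_jx^j}{(1-x)^{D+1}}$. (Equivalently, $\Pi(h,h')=\sum_{i=0}^D c_iA_i(x)(1-x)^{D-i}$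 where $\mathscr{E}(h)\mathscr{E}(h')=\sum_i c_ix^i$ and $A_i$ is the Eulerian polynomial with $\sum_{t\ge0}t^ix^t=A_i(x)/(1-x)^{i+1}$.) If $h,h'$ are the $h^*$-vectors of lattice polytopes $P,P'$, then $\Pi(h,h')$ is the $h^*$-vector of $P\times P'$. -}

module Defs where

open import Data.Nat as ℕ using (ℕ; zero; suc; _+_; _*_; _∸_; _≤_; _<_)
open import Data.Nat.Combinatorics using (_C_)
open import Data.Integer as ℤ using (ℤ)
open import Data.Vec using (Vec; []; _∷_; tabulate)
open import Data.Fin using (toℕ)
open import Data.Product using (Σ; _×_; ∃; ∃-syntax)

-- Total lookup by a natural-number index; returns the default value
-- `z` for out-of-range indices (convention h_j = 0 outside 0..d).
at : ∀ {A : Set} {n : ℕ} → A → Vec A n → ℕ → A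
at z []       _       = z
at z (x ∷ xs) zero    = x
at z (x ∷ xs) (suc j) = at z xs j

_!_ : ∀ {n} → Vec ℕ n → ℕ → ℕ
h ! j = at 0 h j

∑ : ℕ → (ℕ → ℕ) → ℕ
∑ zero    f = 0
∑ (suc n) f = ∑ n f + f n

∑ℤ : ℕ → (ℕ → ℤ) → ℤ
∑ℤ zero    f = ℤ.0ℤ
∑ℤ (suc n) f = ∑ℤ n f ℤ.+ f n

-- Σ_{j=a}^{b} f j  (empty when b < a)
rangeSum : ℕ → ℕ → (ℕ → ℕ) → ℕ
rangeSum a b f = ∑ (suc b ∸ a) (λ k → f (a + k))

Unimodal : ∀ {A : Set} → (A → A → Set) → ℕ → (ℕ → A) → Set
Unimodal _≼_ n f =
  ∃[ i ] (i ≤ n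
         × (∀ j → j < i → f j ≼ f (suc j))
         × (∀ j → i ≤ j → j < n → f (suc j) ≼ f j))

-- Ehrhart polynomial evaluated at t ∈ ℕ:  𝓔(h)(t) = Σ_{i=0}^d h_i C(t+d-i, d)
𝓔 : ∀ {d} → Vec ℕ (suc d) → ℕ → ℕ
𝓔 {d} h t = ∑ (suc d) (λ i → (h ! i) * ((t + d ∸ i) C d))

sgn : ℕ → ℤ
sgn zero          = ℤ.1ℤ
sgn (suc zero)    = ℤ.-1ℤ
sgn (suc (suc k)) = sgn k

-- Π(h,h'): g_j is the coefficient of x^j in
--   (1-x)^{D+1} · Σ_{t≥0} 𝓔(h)(t) 𝓔(h')(t) x^t ,   D = d + d',
-- i.e. g_j = Σ_{k=0}^{j} (-1)^k C(D+1,k) 𝓔(h)(j-k) 𝓔(h')(j-k),  j = 0..D.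
Π : ∀ {d d'} → Vec ℕ (suc d) → Vec ℕ (suc d') → Vec ℤ (suc (d + d'))
Π {d} {d'} h h' = tabulate λ jf →
  let j = toℕ jf ; D = d + d' in
  ∑ℤ (suc j) (λ k → sgn k ℤ.* ℤ.+ ((suc D C k) * (𝓔 h (j ∸ k) * 𝓔 h' (j ∸ k))))

{-# OPTIONS --safe #-}
-- An explicit witness with d = 24: h★ is all ones up to a single tall entry at index 13 and
-- vanishes after s = 14. Every required property is a bounded statement about natural numbers
-- or integers, hence decided by evaluation; non-unimodality of Π(h★, h★) follows from one
-- strict local minimum.
module Submission where

open import Defs
open import Level using (0ℓ)
open import Data.Nat using (ℕ; suc; _+_; _∸_; _≤_; _<_; _≥_; z≤n; s≤s; _≤?_; _<?_; _≟_)
open import Data.Nat.DivMod using (_/_)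
open import Data.Nat.Properties using (allUpTo?; ≰⇒>; <⇒≤; ≤-pred)
open import Data.Integer as ℤ using (ℤ)
open import Data.Vec using (Vec; _∷_; _++_; replicate)
open import Data.Product using (Σ; _×_; ∃-syntax; _,_)
open import Relation.Nullary using (¬_; yes; no; _→-dec_)
open import Relation.Nullary.Decidable using (True; toWitness; toWitnessFalse)
open import Relation.Unary using (Pred; Decidable)
open import Relation.Binary.PropositionalEquality using (_≡_; _≢_)

module _ {P : Pred ℕ 0ℓ} (P? : Decidable P) where

  ∀≤-by-computation : ∀ k → True (allUpTo? P? (suc k)) → ∀ i → i ≤ k → P i
  ∀≤-by-computation k holds i i≤k = toWitness holds (s≤s i≤k)

  ∀≤⇒-by-computation : ∀ {Q : Pred ℕ 0ℓ} (Q? : Decidable Q) k →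
                       True (allUpTo? (λ i → Q? i →-dec P? i) (suc k)) →
                       ∀ i → Q i → i ≤ k → P i
  ∀≤⇒-by-computation Q? k holds i qi i≤k = toWitness holds (s≤s i≤k) qi

dip⇒¬Unimodal : ∀ {A : Set} (_≼_ : A → A → Set) {n} (f : ℕ → A) j →
                suc j < n → ¬ (f j ≼ f (suc j)) → ¬ (f (suc (suc j)) ≼ f (suc j)) →
                ¬ Unimodal _≼_ n f
dip⇒¬Unimodal _≼_ f j j+1<n ¬rise ¬fall (i , _ , up , down) with suc j ≤? i
... | yes j<i = ¬rise (up j j<i)
... | no  j≮i = ¬fall (down (suc j) (<⇒≤ (≰⇒> j≮i)) j+1<n)

h★ : Vec ℕ 25
h★ = replicate 13 1 ++ 10 ∷ 1 ∷ replicate 10 0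

h★-unimodal : Unimodal _≤_ 24 (h★ !_)
h★-unimodal = 13 , toWitness {a? = 13 ≤? 24} _
  , (λ j j<13 → ∀≤-by-computation (λ j → h★ ! j ≤? h★ ! suc j) 12 _ j (≤-pred j<13))
  , (λ j 13≤j j<24 → ∀≤⇒-by-computation (λ j → h★ ! suc j ≤? h★ ! j) (13 ≤?_) 23 _ j 13≤j (≤-pred j<24))

Π-h★-not-unimodal : ¬ Unimodal ℤ._≤_ 48 (at ℤ.0ℤ (Π h★ h★))
Π-h★-not-unimodal = dip⇒¬Unimodal ℤ._≤_ g 21 (toWitness {a? = 22 <? 48} _)
  (toWitnessFalse {a? = g 21 ℤ.≤? g 22} _) (toWitnessFalse {a? = g 23 ℤ.≤? g 22} _)
  where g = at ℤ.0ℤ (Π h★ h★)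

h★-support : 14 ≤ 24 × (h★ ! 14) ≢ 0 × (∀ j → 14 < j → j ≤ 24 → (h★ ! j) ≡ 0)
h★-support = toWitness {a? = 14 ≤? 24} _ , (λ ())
  , (λ j 14<j j≤24 → ∀≤⇒-by-computation (λ j → h★ ! j ≟ 0) (14 <?_) 24 _ j 14<j j≤24)

h★-middle-sums : ∀ i → 2 ≤ i → i ≤ 24 / 2 →
                 rangeSum 2 i (h★ !_) ≥ rangeSum (24 + 1 ∸ i) (24 ∸ 1) (h★ !_)
h★-middle-sums i 2≤i i≤12 = ∀≤⇒-by-computation
  (λ i → rangeSum (24 + 1 ∸ i) (24 ∸ 1) (h★ !_) ≤? rangeSum 2 i (h★ !_)) (2 ≤?_) 12 _ i 2≤i i≤12

h★-initial-sums : ∀ i → i ≤ 14 / 2 → rangeSum 0 i (h★ !_) ≤ rangeSum (14 ∸ i) 14 (h★ !_)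
h★-initial-sums = ∀≤-by-computation (λ i → rangeSum 0 i (h★ !_) ≤? rangeSum (14 ∸ i) 14 (h★ !_)) 7 _

h★-window-sums : ∀ i → 1 ≤ i → i ≤ 24 ∸ 1 →
                 (h★ ! 0) + (h★ ! 1) ≤ rangeSum (i ∸ (24 ∸ 14)) i (h★ !_)
h★-window-sums = ∀≤⇒-by-computation
  (λ i → (h★ ! 0) + (h★ ! 1) ≤? rangeSum (i ∸ (24 ∸ 14)) i (h★ !_)) (1 ≤?_) 23 _

theorem3p3 : ∃[ d ] Σ (Vec ℕ (suc d)) λ h →
    d ≥ 1
    × Unimodal _≤_ d (h !_)
    × ¬ Unimodal ℤ._≤_ (d + d) (at ℤ.0ℤ (Π h h))
    × ∃[ s ] ((s ≤ d × (h ! s) ≢ 0 × (∀ j → s < j → j ≤ d → (h ! j) ≡ 0))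
    × (h ! 1) ≥ (h ! d)
    × (∀ i → 2 ≤ i → i ≤ d / 2 →
    rangeSum 2 i (h !_) ≥ rangeSum (d + 1 ∸ i) (d ∸ 1) (h !_))
    × (∀ i → i ≤ s / 2 →
    rangeSum 0 i (h !_) ≤ rangeSum (s ∸ i) s (h !_))
    × (s ≡ d → ∀ i → 1 ≤ i → i ≤ d ∸ 1 → (h ! 1) ≤ (h ! i))
    × (s ≤ d ∸ 1 → ∀ i → 1 ≤ i → i ≤ d ∸ 1 →
    (h ! 0) + (h ! 1) ≤ rangeSum (i ∸ (d ∸ s)) i (h !_)))
theorem3p3 = 24 , h★ , s≤s z≤n , h★-unimodal , Π-h★-not-unimodal
  , 14 , h★-support
  , z≤n
  , h★-middle-sums
  , h★-initial-sums
  , (λ ())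
  , (λ _ → h★-window-sums)
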